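{- Let $n \geq 2$ and suppose the PPM* encoder, run on the sequence $S$, has already processed the prefix $S_1 S_2 \cdots S_{n-1}$. Then once it has further processed the first $2^n + n$ bits of $S_n$ (i.e. $S_n[0..2^n+n-1]$), its model contains a context for every $w \in \{0,1\}^n$.
   Context: Strings are binary and indexed from $0$; $x[i..j]$ denotes bits $i$ through $j$ (empty if $j<i$); $x^t$ is $t$-fold concatenation. $\mathrm{occ}(w,x)$ is the number of positions at which $w$ occurs as a substring of $x$ (for $w$ empty, $|x|+1$). For $n\ge1$, $db(n)$ is the lexicographically least de Bruijn string of order $n$ (length $2^n$, cyclically containing every length-$n$ binary string once), built by: start with $x=1^{n-1}$; while possible append a bit (preferring $0$) keeping every length-$n$ substring of $x$ unique; then delete the prefix $1^{n-1}$. $db_i(n) = db(n)[i..2^n-1]\,db(n)[0..i-1]$ for $0\le i<2^n$, and $db_i^t(n)$ is its $t$-fold concatenation. For $n = 2^s t$ with $t$ odd, $S_n = db_0^t(n)\,db_1^t(n)\cdots db_{2^s-1}^t(n)$, and $S = S_1S_2S_3\cdots$. PPM* (escape Method C, no exclusion): if $x$ is the part of the input read so far, the model consists of the empty context $\lambda$ and every nonempty string $c$ such that $\mathrm{occ}(cb,x)\ge 1$ for some bit $b$ and such that $c$ with its last bit deleted occurs at least twice in $x$ (contexts are extended only until they are unique). For a context $c$ and bit $b$, the count is $\mathrm{occ}(cb,x)$; the escape count $e(c)$ is the number of bits $b$ with positive count; with $T$ the sum of both counts and $e(c)$, bit $b$ has probability $\mathrm{occ}(cb,x)/T$ and the escape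 symbol probability $e(c)/T$; $c$ is deterministic if $e(c)=1$. -}

module Defs where

open import Data.Bool using (Bool; true; false; if_then_else_; _∧_; _∨_; not)
open import Data.Nat using (ℕ; zero; suc; _+_; _*_; _∸_; _^_; _≤_)
open import Data.List using (List; []; _∷_; _++_; length; drop; take; replicate; concat; map; upTo; [_])
open import Data.Product using (_×_; _,_; ∃)
open import Relation.Binary.PropositionalEquality using (_≡_)
open import Relation.Nullary using (¬_)

-- Binary strings: false = 0, true = 1.
Bits : Set
Bits = List Bool

_==b_ : Bool → Bool → Bool
false ==b false = true
true  ==b true  = true
_     ==b _     = false

_==_ : Bits → Bits → Bool
[]       == []       = true
(a ∷ as) == (b ∷ bs) = (a ==b b) ∧ (as == bs)
_        == _        = false

isPrefix : Bits → Bits → Bool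
isPrefix []       _        = true
isPrefix (_ ∷ _)  []       = false
isPrefix (a ∷ as) (b ∷ bs) = (a ==b b) ∧ isPrefix as bs

-- occ(w,x): number of positions at which w occurs in x (|x|+1 for empty w)
occ : Bits → Bits → ℕ
occ w []       = if isPrefix w [] then 1 else 0
occ w (b ∷ x)  = (if isPrefix w (b ∷ x) then 1 else 0) + occ w x

windows : ℕ → Bits → List Bits
windows n []      = if n Data.Nat.≡ᵇ 0 then [ [] ] else []
windows n (b ∷ x) = (if length (b ∷ x) Data.Nat.<ᵇ n then [] else [ take n (b ∷ x) ]) ++ windows n x

elem : Bits → List Bits → Bool
elem w []       = false
elem w (v ∷ vs) = (w == v) ∨ elem w vs

allDistinct : List Bits → Bool
allDistinct []       = true
allDistinct (v ∷ vs) = not (elem v vs) ∧ allDistinct vs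

uniqueWindows : ℕ → Bits → Bool
uniqueWindows n x = allDistinct (windows n x)

-- The fuel 2^n is sufficient: each append creates a new distinct length-n
-- substring, of which there are at most 2^n.
dbLoop : ℕ → ℕ → Bits → Bits
dbLoop n zero    x = x
dbLoop n (suc f) x =
  if uniqueWindows n (x ++ [ false ]) then dbLoop n f (x ++ [ false ])
  else if uniqueWindows n (x ++ [ true ]) then dbLoop n f (x ++ [ true ])
  else x

-- db(n): lexicographically least de Bruijn string of order n
db : ℕ → Bits
db n = drop (n ∸ 1) (dbLoop n (2 ^ n) (replicate (n ∸ 1) true))

dbRot : ℕ → ℕ → Bits
dbRot n i = drop i (db n) ++ take i (db n)

pow : Bits → ℕ → Bits
pow x t = concat (replicate t x)

-- decomposition n = 2^s * t with t odd (for n ≥ 1); fuel-driven recursion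
isEven : ℕ → Bool
isEven zero          = true
isEven (suc zero)    = false
isEven (suc (suc m)) = isEven m

half : ℕ → ℕ
half zero          = zero
half (suc zero)    = zero
half (suc (suc m)) = suc (half m)

twoAdicGo : ℕ → ℕ → ℕ × ℕ
twoAdicGo zero    m = (0 , m)
twoAdicGo (suc f) zero = (0 , zero)
twoAdicGo (suc f) (suc m) with isEven (suc m)
... | true  with twoAdicGo f (half (suc m))
...   | (s , t) = (suc s , t)
twoAdicGo (suc f) (suc m) | false = (0 , suc m)

twoAdic : ℕ → ℕ × ℕ
twoAdic n = twoAdicGo n n

Sblock : ℕ → Bits
Sblock n with twoAdic n
... | (s , t) = concat (map (λ i → pow (dbRot n i) t) (upTo (2 ^ s)))

Sprefix : ℕ → Bits
Sprefix m = concat (map (λ i → Sblock (suc i)) (upTo m))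

dropLast : Bits → Bits
dropLast []          = []
dropLast (_ ∷ [])    = []
dropLast (a ∷ b ∷ c) = a ∷ dropLast (b ∷ c)

-- nonempty c is a context of the PPM* model after reading x
IsContext : Bits → Bits → Set
IsContext x c =
  ¬ (c ≡ []) × (∃ λ (b : Bool) → 1 ≤ occ (c ++ [ b ]) x) × (2 ≤ occ (dropLast c) x)

-- db(n) arises from the greedy loop run on 1^(n-1); write L = 1^(n-1) db(n) for the string it
-- builds. As long as all windows of length n in L are distinct, every word u of length n-1
-- occurs as often as it is entered (preceded by a bit, or is the prefix 1^(n-1)) and as often
-- as it is left (followed by a bit, or is the suffix of L). When the loop ends, the final
-- suffix s is followed by both bits somewhere in L: either both extensions were rejected, or
-- the loop used all its fuel and a counting argument shows that L contains every window.
-- Then s is left three times but entered at most twice, so s = 1^(n-1) and in- and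
-- out-degrees agree everywhere. Since the loop prefers 0, an occurrence of u1 forces one of
-- u0; together with the balance this gives, by induction on the bits in front of a final
-- run of 1s, that every word of length n occurs in L, hence in db(n) 0^(n-1).
-- S_n starts with db(n) 0^(n-1) b for some bit b, inside its first 2^n + n bits, so every
-- word w of length n is followed by a bit there and w without its last bit occurs twice.

module Submission where

open import Defs
open import Data.Bool using (Bool; true; false; if_then_else_; _∧_; _∨_; not; T)
open import Data.Bool.Properties using (∨-identityʳ; ∧-identityʳ)
open import Data.Empty using (⊥-elim)
open import Data.List
  using (List; []; _∷_; _++_; [_]; length; take; drop; replicate; concat; map; upTo; applyUpTo; initLast; _∷ʳ′_)
open import Data.List.Properties
  using (length-++; length-++-≤ˡ; length-++-≤ʳ; length-replicate; length-take; length-drop; ++-assoc;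
         ++-identityʳ; ++-conicalʳ; ∷-injectiveʳ; take++drop≡id; take-all; map-++; map-∘)
open import Data.Nat using (ℕ; zero; suc; _+_; _*_; _∸_; _^_; _≤_; _<_; z≤n; s≤s; _<ᵇ_)
open import Data.Nat.ListAction using (sum)
open import Data.Nat.ListAction.Properties using (sum-++)
open import Data.Nat.Properties
open import Data.Product using (_×_; _,_; ∃; ∃₂; proj₁; proj₂)
open import Data.Sum using (_⊎_; inj₁; inj₂; map₁)
open import Data.Unit using (tt)
open import Data.Vec using (Vec; toList)
open import Data.Vec.Properties using (length-toList)
open import Relation.Binary.PropositionalEquality
  using (_≡_; refl; sym; trans; cong; cong₂; subst; subst₂; module ≡-Reasoning)
open import Relation.Nullary using (¬_; yes; no)

open import Algebra.Properties.CommutativeSemigroup +-commutativeSemigroup using (interchange; x∙yz≈y∙xz)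

𝟙 : Bool → ℕ
𝟙 b = if b then 1 else 0

𝟙≤1 : ∀ b → 𝟙 b ≤ 1
𝟙≤1 true  = s≤s z≤n
𝟙≤1 false = z≤n

𝟙-pos : ∀ {q} → 1 ≤ 𝟙 q → q ≡ true
𝟙-pos {true} _ = refl

∧-true⁻ : ∀ {a b} → a ∧ b ≡ true → a ≡ true × b ≡ true
∧-true⁻ {true} {true} _ = refl , refl

not≡true⇒≡false : ∀ {a} → not a ≡ true → a ≡ false
not≡true⇒≡false {false} _ = refl

0<ᵇ≡false⇒≡0 : ∀ {k} → (0 <ᵇ k) ≡ false → k ≡ 0
0<ᵇ≡false⇒≡0 {zero} _ = refl

<ᵇ≡false⇒≥ : ∀ {m n} → (m <ᵇ n) ≡ false → n ≤ m
<ᵇ≡false⇒≥ e = ≮⇒≥ (λ m<n → subst T e (<⇒<ᵇ m<n))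

1≤+𝟙∧⁻ : ∀ o q r → 1 ≤ o + 𝟙 (q ∧ r) → 1 ≤ o ⊎ (q ≡ true × r ≡ true)
1≤+𝟙∧⁻ (suc o) q     r     _ = inj₁ (s≤s z≤n)
1≤+𝟙∧⁻ zero    true  true  _ = inj₂ (refl , refl)
1≤+𝟙∧⁻ zero    true  false ()
1≤+𝟙∧⁻ zero    false r     ()

+𝟙∧≤1 : ∀ o q r → o ≤ 1 → (q ≡ true → r ≡ true → o ≡ 0) → o + 𝟙 (q ∧ r) ≤ 1
+𝟙∧≤1 o true  true  _   o≡0 rewrite o≡0 refl refl = s≤s z≤n
+𝟙∧≤1 o true  false o≤1 _   rewrite +-identityʳ o = o≤1
+𝟙∧≤1 o false r     o≤1 _   rewrite +-identityʳ o = o≤1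

==b-refl : ∀ a → (a ==b a) ≡ true
==b-refl true  = refl
==b-refl false = refl

==b⇒≡ : ∀ {a b} → (a ==b b) ≡ true → a ≡ b
==b⇒≡ {true}  {true}  _ = refl
==b⇒≡ {false} {false} _ = refl

==-refl : ∀ x → (x == x) ≡ true
==-refl []      = refl
==-refl (a ∷ x) rewrite ==b-refl a = ==-refl x

==⇒≡ : ∀ {x y} → (x == y) ≡ true → x ≡ y
==⇒≡ {[]}        {[]}        _ = refl
==⇒≡ {true ∷ x}  {true ∷ y}  e = cong (true ∷_) (==⇒≡ e)
==⇒≡ {false ∷ x} {false ∷ y} e = cong (false ∷_) (==⇒≡ e)

length-∷ʳ : ∀ (u : Bits) c {m} → length u ≡ m → length (u ++ [ c ]) ≡ suc m
length-∷ʳ u c refl = trans (length-++ u) (+-comm (length u) 1)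

length-∷ʳ⁻ : ∀ (u : Bits) c {m} → length (u ++ [ c ]) ≡ suc m → length u ≡ m
length-∷ʳ⁻ u c e = suc-injective (trans (sym (length-∷ʳ u c refl)) e)

∷ʳ≢[] : ∀ (u : Bits) c → ¬ (u ++ [ c ] ≡ [])
∷ʳ≢[] u c e with () ← ++-conicalʳ u [ c ] e

dropLast-∷ʳ : ∀ u c → dropLast (u ++ [ c ]) ≡ u
dropLast-∷ʳ []          c = refl
dropLast-∷ʳ (a ∷ [])    c = refl
dropLast-∷ʳ (a ∷ b ∷ u) c = cong (a ∷_) (dropLast-∷ʳ (b ∷ u) c)

take-length-++ : ∀ (A B : Bits) k → take (length A + k) (A ++ B) ≡ A ++ take k B
take-length-++ []      B k = refl
take-length-++ (a ∷ A) B k = cong (a ∷_) (take-length-++ A B k)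

take-++-prefix : ∀ (P Q : Bits) K → length P ≤ K → ∃ λ R → take K (P ++ Q) ≡ P ++ R
take-++-prefix []      Q K       _       = take K Q , refl
take-++-prefix (a ∷ P) Q (suc K) (s≤s l) = let R , e = take-++-prefix P Q K l in R , cong (a ∷_) e

++-∷-nonEmpty : ∀ (r : Bits) c T → ∃₂ λ b R → r ++ c ∷ T ≡ b ∷ R
++-∷-nonEmpty []      c T = c , T , refl
++-∷-nonEmpty (d ∷ r) c T = d , r ++ c ∷ T , refl

++-suffix : ∀ (A D p B : Bits) → A ++ D ≡ p ++ B → length B ≤ length D → ∃ λ C → D ≡ C ++ B
++-suffix []      D p       B e l = p , e
++-suffix (a ∷ A) D []      B refl l = ⊥-elim (n≮n _ (≤-trans (s≤s (length-++-≤ʳ D {A})) l))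
++-suffix (a ∷ A) D (q ∷ p) B e l = ++-suffix A D p B (∷-injectiveʳ e) l

splitSuffix : ∀ m (x : Bits) → m ≤ length x → ∃₂ λ p s → x ≡ p ++ s × length s ≡ m
splitSuffix m x m≤ =
  take (length x ∸ m) x , drop (length x ∸ m) x ,
  sym (take++drop≡id (length x ∸ m) x) , trans (length-drop (length x ∸ m) x) (m∸[m∸n]≡n m≤)

ones zeros : ℕ → Bits
ones k  = replicate k true
zeros k = replicate k false

replicate-+ : ∀ a b (c : Bool) → replicate (a + b) c ≡ replicate a c ++ replicate b c
replicate-+ zero    b c = refl
replicate-+ (suc a) b c = cong (c ∷_) (replicate-+ a b c)

replicate-∷ʳ : ∀ k (c : Bool) → replicate k c ++ [ c ] ≡ replicate (suc k) c
replicate-∷ʳ zero    c = refl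
replicate-∷ʳ (suc k) c = cong (c ∷_) (replicate-∷ʳ k c)

zeros-suc-++ : ∀ m r → zeros (suc m) ++ r ≡ zeros m ++ false ∷ r
zeros-suc-++ m r = trans (cong (_++ r) (sym (replicate-∷ʳ m false))) (++-assoc (zeros m) [ false ] r)

ones++zeros-∷ʳ : ∀ m k → (ones m ++ zeros k) ++ [ false ] ≡ ones m ++ zeros (suc k)
ones++zeros-∷ʳ m k = trans (++-assoc (ones m) (zeros k) [ false ]) (cong (ones m ++_) (replicate-∷ʳ k false))

drop-ones : ∀ m Y → drop m (ones m ++ Y) ≡ Y
drop-ones zero    Y = refl
drop-ones (suc m) Y = drop-ones m Y

take-zeros : ∀ m r → take m (zeros (suc m) ++ r) ≡ zeros m
take-zeros zero    r = refl
take-zeros (suc m) r = cong (false ∷_) (take-zeros m r)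

-- Prefixes and occurrences

isPrefix-++ : ∀ v r → isPrefix v (v ++ r) ≡ true
isPrefix-++ []      r = refl
isPrefix-++ (a ∷ v) r rewrite ==b-refl a = isPrefix-++ v r

isPrefix⇒++ : ∀ v z → isPrefix v z ≡ true → ∃ λ r → z ≡ v ++ r
isPrefix⇒++ []          z           _ = z , refl
isPrefix⇒++ (true ∷ v)  (true ∷ z)  e = let r , z≡ = isPrefix⇒++ v z e in r , cong (true ∷_) z≡
isPrefix⇒++ (false ∷ v) (false ∷ z) e = let r , z≡ = isPrefix⇒++ v z e in r , cong (false ∷_) z≡

isPrefix⇒≡take : ∀ v z → isPrefix v z ≡ true → v ≡ take (length v) z
isPrefix⇒≡take v z e with isPrefix⇒++ v z e
... | r , refl = sym (trans (cong (λ k → take k (v ++ r)) (sym (+-identityʳ (length v))))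
                             (trans (take-length-++ v r 0) (++-identityʳ v)))

isPrefix⇒≤ : ∀ v z → isPrefix v z ≡ true → length v ≤ length z
isPrefix⇒≤ v z e with isPrefix⇒++ v z e
... | r , refl = length-++-≤ˡ v

isPrefix-extend : ∀ v z t → isPrefix v z ≡ true → isPrefix v (z ++ t) ≡ true
isPrefix-extend v z t e with isPrefix⇒++ v z e
... | r , refl rewrite ++-assoc v r t = isPrefix-++ v (r ++ t)

isPrefix-++⁻ : ∀ u x z → isPrefix (u ++ x) z ≡ true → isPrefix u z ≡ true
isPrefix-++⁻ u x z e with isPrefix⇒++ (u ++ x) z e
... | r , refl rewrite ++-assoc u x r = isPrefix-++ u (x ++ r)

isPrefix-short : ∀ v z → length z < length v → isPrefix v z ≡ false
isPrefix-short (a ∷ v)     []          _       = refl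
isPrefix-short (true ∷ v)  (true ∷ z)  (s≤s l) = isPrefix-short v z l
isPrefix-short (true ∷ v)  (false ∷ z) _       = refl
isPrefix-short (false ∷ v) (true ∷ z)  _       = refl
isPrefix-short (false ∷ v) (false ∷ z) (s≤s l) = isPrefix-short v z l

isPrefix-++ʳ : ∀ v z t → length v ≤ length z → isPrefix v (z ++ t) ≡ isPrefix v z
isPrefix-++ʳ []      z       t _       = refl
isPrefix-++ʳ (a ∷ v) (b ∷ z) t (s≤s l) rewrite isPrefix-++ʳ v z t l = refl

isPrefix-sameLength : ∀ u A D → length u ≡ length A → isPrefix u (A ++ D) ≡ (u == A)
isPrefix-sameLength []      []      D _ = refl
isPrefix-sameLength (a ∷ u) (b ∷ A) D e rewrite isPrefix-sameLength u A D (suc-injective e) = refl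

isPrefix-take : ∀ v z K → isPrefix v z ≡ true → length v ≤ K → isPrefix v (take K z) ≡ true
isPrefix-take []          z           K       e l       = refl
isPrefix-take (true ∷ v)  (true ∷ z)  (suc K) e (s≤s l) = isPrefix-take v z K e l
isPrefix-take (false ∷ v) (false ∷ z) (suc K) e (s≤s l) = isPrefix-take v z K e l

isPrefix-take-self : ∀ k z → isPrefix (take k z) z ≡ true
isPrefix-take-self k z =
  subst (λ y → isPrefix (take k z) y ≡ true) (take++drop≡id k z) (isPrefix-++ (take k z) (drop k z))

isPrefix-as-take : ∀ t z →
  isPrefix t z ≡ (if length z <ᵇ length t then false else (t == take (length t) z))
isPrefix-as-take []      z       = refl
isPrefix-as-take (a ∷ t) []      = refl
isPrefix-as-take (a ∷ t) (b ∷ z) rewrite isPrefix-as-take t z with length z <ᵇ length t | a ==b b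
... | true  | true  = refl
... | true  | false = refl
... | false | true  = refl
... | false | false = refl

isPrefix-∷ʳ : ∀ u s c b → length u ≡ length s →
  isPrefix (u ++ [ c ]) (s ++ [ b ]) ≡ (u == s) ∧ (c ==b b)
isPrefix-∷ʳ []          []          c b _ = ∧-identityʳ _
isPrefix-∷ʳ (true ∷ u)  (true ∷ s)  c b e = isPrefix-∷ʳ u s c b (suc-injective e)
isPrefix-∷ʳ (true ∷ u)  (false ∷ s) c b e = refl
isPrefix-∷ʳ (false ∷ u) (true ∷ s)  c b e = refl
isPrefix-∷ʳ (false ∷ u) (false ∷ s) c b e = isPrefix-∷ʳ u s c b (suc-injective e)

isPrefix-∷ʳ-exclusive : ∀ u z →
  isPrefix (u ++ [ false ]) z ≡ true → isPrefix (u ++ [ true ]) z ≡ false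
isPrefix-∷ʳ-exclusive []          (false ∷ z) e = refl
isPrefix-∷ʳ-exclusive (true ∷ u)  (true ∷ z)  e = isPrefix-∷ʳ-exclusive u z e
isPrefix-∷ʳ-exclusive (false ∷ u) (false ∷ z) e = isPrefix-∷ʳ-exclusive u z e

occ-pos : ∀ v z → isPrefix v z ≡ true → 1 ≤ occ v z
occ-pos v []      e rewrite e = s≤s z≤n
occ-pos v (b ∷ z) e rewrite e = s≤s z≤n

occ-∷-prefix : ∀ v b x → isPrefix v (b ∷ x) ≡ true → occ v (b ∷ x) ≡ suc (occ v x)
occ-∷-prefix v b x e rewrite e = refl

occ-short : ∀ v z → length z < length v → occ v z ≡ 0
occ-short v []      l rewrite isPrefix-short v [] l = refl
occ-short v (b ∷ z) l rewrite isPrefix-short v (b ∷ z) l = occ-short v z (<-trans (n<1+n _) l)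

occ-∷ʳ-short : ∀ u c s → length u ≡ length s → occ (u ++ [ c ]) s ≡ 0
occ-∷ʳ-short u c s e = occ-short (u ++ [ c ]) s (≤-reflexive (sym (length-∷ʳ u c e)))

occ-sameLength : ∀ v z → length z ≡ length v → occ v z ≡ 𝟙 (isPrefix v z)
occ-sameLength v []      e = refl
occ-sameLength v (b ∷ z) e rewrite occ-short v z (subst (length z <_) e ≤-refl) = +-identityʳ _

occ-++ˡ-mono : ∀ v a z → occ v z ≤ occ v (a ++ z)
occ-++ˡ-mono v []      z = ≤-refl
occ-++ˡ-mono v (b ∷ a) z = ≤-trans (occ-++ˡ-mono v a z) (m≤n+m _ _)

occ-++ʳ-mono : ∀ v z t → occ v z ≤ occ v (z ++ t)
occ-++ʳ-mono v [] [] = ≤-refl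
occ-++ʳ-mono v [] (c ∷ t) with isPrefix v [] in e
... | false = z≤n
... | true rewrite isPrefix-extend v [] (c ∷ t) e = s≤s z≤n
occ-++ʳ-mono v (b ∷ z) t with isPrefix v (b ∷ z) in e
... | false = ≤-trans (occ-++ʳ-mono v z t) (m≤n+m _ _)
... | true rewrite isPrefix-extend v (b ∷ z) t e = s≤s (occ-++ʳ-mono v z t)

occ⇒infix : ∀ v z → 1 ≤ occ v z → ∃₂ λ a r → z ≡ a ++ v ++ r
occ⇒infix v [] h with isPrefix v [] in e
... | true = let r , z≡ = isPrefix⇒++ v [] e in [] , r , z≡
occ⇒infix v (b ∷ z) h with isPrefix v (b ∷ z) in e
... | true  = let r , z≡ = isPrefix⇒++ v (b ∷ z) e in [] , r , z≡
... | false = let a , r , z≡ = occ⇒infix v z h in b ∷ a , r , cong (b ∷_) z≡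

infix⇒occ : ∀ a v r → 1 ≤ occ v (a ++ v ++ r)
infix⇒occ a v r = ≤-trans (occ-pos v (v ++ r) (isPrefix-++ v r)) (occ-++ˡ-mono v a (v ++ r))

occ-++⁻ : ∀ u x Z → 1 ≤ occ (u ++ x) Z → 1 ≤ occ u Z
occ-++⁻ u x Z h with occ⇒infix (u ++ x) Z h
... | a , r , refl rewrite ++-assoc u x r = infix⇒occ a u (x ++ r)

occ-++-split : ∀ v A B → 1 ≤ occ v (A ++ B) →
  1 ≤ occ v (A ++ take (length v ∸ 1) B) ⊎ 1 ≤ occ v B
occ-++-split v []      B h = inj₂ h
occ-++-split v (a ∷ A) B h with isPrefix v (a ∷ A ++ B) in e
... | true  = inj₁ (occ-pos v (a ∷ A ++ take (length v ∸ 1) B)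
                 (subst (λ z → isPrefix v z ≡ true) (take-length-++ (a ∷ A) B (length v ∸ 1))
                   (isPrefix-take v (a ∷ A ++ B) _ e v≤)))
  where
  v≤ : length v ≤ suc (length A) + (length v ∸ 1)
  v≤ = ≤-trans (m≤n+m∸n (length v) 1) (+-monoˡ-≤ (length v ∸ 1) (s≤s z≤n))
... | false with occ-++-split v A B h
...   | inj₁ h′ = inj₁ (≤-trans h′ (occ-++ˡ-mono v [ a ] (A ++ take (length v ∸ 1) B)))
...   | inj₂ h′ = inj₂ h′

occ-extend : ∀ w Z c T → 1 ≤ occ w Z → ∃ λ b → 1 ≤ occ (w ++ [ b ]) (Z ++ c ∷ T)
occ-extend w Z c T h with occ⇒infix w Z h
... | a , r , refl with ++-∷-nonEmpty r c T
...   | b , R , r++ = b , subst (λ z → 1 ≤ occ (w ++ [ b ]) z) (sym text≡) (infix⇒occ a (w ++ [ b ]) R)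
  where
  open ≡-Reasoning
  text≡ : (a ++ w ++ r) ++ c ∷ T ≡ a ++ (w ++ [ b ]) ++ R
  text≡ = begin
    (a ++ w ++ r) ++ c ∷ T   ≡⟨ ++-assoc a (w ++ r) (c ∷ T) ⟩
    a ++ (w ++ r) ++ c ∷ T   ≡⟨ cong (a ++_) (++-assoc w r (c ∷ T)) ⟩
    a ++ w ++ r ++ c ∷ T     ≡⟨ cong (λ z → a ++ w ++ z) r++ ⟩
    a ++ w ++ b ∷ R          ≡⟨ cong (a ++_) (++-assoc w [ b ] R) ⟨
    a ++ (w ++ [ b ]) ++ R   ∎

occ-bothExtensions : ∀ u Y → 1 ≤ occ (u ++ [ false ]) Y → 1 ≤ occ (u ++ [ true ]) Y → 2 ≤ occ u Y
occ-bothExtensions u [] h0 h1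
  with () ← subst (1 ≤_) (occ-short (u ++ [ false ]) [] (subst (0 <_) (sym (length-∷ʳ u false refl)) (s≤s z≤n))) h0
occ-bothExtensions u (a ∷ Y) h0 h1
  with isPrefix (u ++ [ false ]) (a ∷ Y) in e0 | isPrefix (u ++ [ true ]) (a ∷ Y) in e1
... | true  | true  with () ← trans (sym (isPrefix-∷ʳ-exclusive u (a ∷ Y) e0)) e1
... | true  | false rewrite isPrefix-++⁻ u [ false ] (a ∷ Y) e0 = s≤s (occ-++⁻ u [ true ] Y h1)
... | false | true  rewrite isPrefix-++⁻ u [ true ] (a ∷ Y) e1 = s≤s (occ-++⁻ u [ false ] Y h0)
... | false | false = ≤-trans (occ-bothExtensions u Y h0 h1) (occ-++ˡ-mono u [ a ] Y)

occ-∷ʳ : ∀ u c p s b → length u ≡ length s →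
  occ (u ++ [ c ]) ((p ++ s) ++ [ b ]) ≡ occ (u ++ [ c ]) (p ++ s) + 𝟙 ((u == s) ∧ (c ==b b))
occ-∷ʳ u c [] s b e
  rewrite occ-sameLength (u ++ [ c ]) (s ++ [ b ]) (trans (length-∷ʳ s b (sym e)) (sym (length-∷ʳ u c refl)))
        | isPrefix-∷ʳ u s c b e | occ-∷ʳ-short u c s e = refl
occ-∷ʳ u c (a ∷ p) s b e
  = trans (cong₂ _+_ (cong 𝟙 (isPrefix-++ʳ (u ++ [ c ]) (a ∷ p ++ s) [ b ] v≤)) (occ-∷ʳ u c p s b e))
          (sym (+-assoc (𝟙 (isPrefix (u ++ [ c ]) (a ∷ p ++ s))) _ _))
  where
  v≤ : length (u ++ [ c ]) ≤ length (a ∷ p ++ s)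
  v≤ = subst₂ _≤_ (sym (length-∷ʳ u c e)) (cong suc (sym (length-++ p)))
                  (s≤s (m≤n+m (length s) (length p)))

-- Distinct windows

AtMostOnce : ℕ → Bits → Set
AtMostOnce n x = ∀ v → length v ≡ n → occ v x ≤ 1

Covers : ℕ → Bits → Set
Covers n x = ∀ v → length v ≡ n → 1 ≤ occ v x

elem-++ : ∀ t xs ys → elem t (xs ++ ys) ≡ elem t xs ∨ elem t ys
elem-++ t []       ys = refl
elem-++ t (v ∷ xs) ys rewrite elem-++ t xs ys with t == v
... | true  = refl
... | false = refl

headWindow : ℕ → Bits → List Bits
headWindow n z = if length z <ᵇ n then [] else [ take n z ]

elem-headWindow : ∀ m t z → length t ≡ suc m → elem t (headWindow (suc m) z) ≡ isPrefix t z
elem-headWindow m t z e rewrite isPrefix-as-take t z | e with length z <ᵇ suc m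
... | true  = refl
... | false = ∨-identityʳ _

elem-windows : ∀ m t x → length t ≡ suc m → elem t (windows (suc m) x) ≡ (0 <ᵇ occ t x)
elem-windows m t []      e rewrite isPrefix-short t [] (subst (0 <_) (sym e) (s≤s z≤n)) = refl
elem-windows m t (b ∷ x) e
  rewrite elem-++ t (headWindow (suc m) (b ∷ x)) (windows (suc m) x)
        | elem-headWindow m t (b ∷ x) e | elem-windows m t x e
  with isPrefix t (b ∷ x)
... | true  = refl
... | false = refl

uniqueWindows-∷⁻ : ∀ m b x →
  uniqueWindows (suc m) (b ∷ x) ≡ true → uniqueWindows (suc m) x ≡ true
uniqueWindows-∷⁻ m b x u with length (b ∷ x) <ᵇ suc m
... | true  = u
... | false = proj₂ (∧-true⁻ u)

uniqueWindows-fresh : ∀ m b x → uniqueWindows (suc m) (b ∷ x) ≡ true →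
  ∀ v → length v ≡ suc m → isPrefix v (b ∷ x) ≡ true → occ v x ≡ 0
uniqueWindows-fresh m b x u v lv pre with length (b ∷ x) <ᵇ suc m in short
... | true  = ⊥-elim (<⇒≱ (subst (length (b ∷ x) <_) (sym lv) (<ᵇ⇒< _ _ (subst T (sym short) tt)))
                         (isPrefix⇒≤ v (b ∷ x) pre))
... | false = 0<ᵇ≡false⇒≡0 (begin
    0 <ᵇ occ v x                                    ≡⟨ elem-windows m v x lv ⟨
    elem v (windows (suc m) x)                      ≡⟨ cong (λ h → elem h (windows (suc m) x)) v≡head ⟩
    elem (take (suc m) (b ∷ x)) (windows (suc m) x) ≡⟨ not≡true⇒≡false (proj₁ (∧-true⁻ u)) ⟩
    false                                           ∎)
  where
  open ≡-Reasoning
  v≡head : v ≡ take (suc m) (b ∷ x)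
  v≡head = trans (isPrefix⇒≡take v (b ∷ x) pre) (cong (λ k → take k (b ∷ x)) lv)

uniqueWindows⇒atMostOnce : ∀ m x → uniqueWindows (suc m) x ≡ true → AtMostOnce (suc m) x
uniqueWindows⇒atMostOnce m []      _ v _  = 𝟙≤1 (isPrefix v [])
uniqueWindows⇒atMostOnce m (b ∷ x) u v lv with isPrefix v (b ∷ x) in pre
... | false = uniqueWindows⇒atMostOnce m x (uniqueWindows-∷⁻ m b x u) v lv
... | true  rewrite uniqueWindows-fresh m b x u v lv pre = s≤s z≤n

atMostOnce-∷⁻ : ∀ {n b x} → AtMostOnce n (b ∷ x) → AtMostOnce n x
atMostOnce-∷⁻ h v lv = ≤-trans (m≤n+m _ _) (h v lv)

headWindow-fresh : ∀ m b x → AtMostOnce (suc m) (b ∷ x) → (length (b ∷ x) <ᵇ suc m) ≡ false →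
  elem (take (suc m) (b ∷ x)) (windows (suc m) x) ≡ false
headWindow-fresh m b x h short = trans (elem-windows m hd x lhd) (cong (0 <ᵇ_) hd-fresh)
  where
  hd = take (suc m) (b ∷ x)
  lhd : length hd ≡ suc m
  lhd = trans (length-take (suc m) (b ∷ x)) (m≤n⇒m⊓n≡m (<ᵇ≡false⇒≥ short))
  hd-fresh : occ hd x ≡ 0
  hd-fresh = n≤0⇒n≡0 (≤-pred (subst (_≤ 1) (occ-∷-prefix hd b x (isPrefix-take-self (suc m) (b ∷ x)))
                                            (h hd lhd)))

atMostOnce⇒uniqueWindows : ∀ m x → AtMostOnce (suc m) x → uniqueWindows (suc m) x ≡ true
atMostOnce⇒uniqueWindows m []      h = refl
atMostOnce⇒uniqueWindows m (b ∷ x) h with length (b ∷ x) <ᵇ suc m in short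
... | true  = atMostOnce⇒uniqueWindows m x (atMostOnce-∷⁻ h)
... | false rewrite atMostOnce⇒uniqueWindows m x (atMostOnce-∷⁻ h) | headWindow-fresh m b x h short
  = refl

atMostOnce-∷ʳ : ∀ m p s b → length s ≡ m → AtMostOnce (suc m) (p ++ s) →
  occ (s ++ [ b ]) (p ++ s) ≡ 0 → AtMostOnce (suc m) ((p ++ s) ++ [ b ])
atMostOnce-∷ʳ m p s b ls once new v lv with initLast v | lv
... | u ∷ʳ′ c | _ rewrite occ-∷ʳ u c p s b (trans (length-∷ʳ⁻ u c lv) (sym ls)) =
  +𝟙∧≤1 _ (u == s) (c ==b b) (once (u ++ [ c ]) lv)
    (λ u≡s c≡b → subst₂ (λ u′ c′ → occ (u′ ++ [ c′ ]) (p ++ s) ≡ 0)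
                        (sym (==⇒≡ u≡s)) (sym (==b⇒≡ c≡b)) new)

-- The greedy loop

ZeroFirst : ℕ → Bits → Set
ZeroFirst m x = ∀ u → length u ≡ m → 1 ≤ occ (u ++ [ true ]) x → 1 ≤ occ (u ++ [ false ]) x

short⇒zeroFirst : ∀ m x → length x ≤ m → ZeroFirst m x
short⇒zeroFirst m x lx u lu u1
  with () ← subst (1 ≤_) (occ-short (u ++ [ true ]) x
                           (subst (suc (length x) ≤_) (sym (length-∷ʳ u true lu)) (s≤s lx))) u1

zeroFirst-∷ʳ : ∀ m p s b → length s ≡ m → ZeroFirst m (p ++ s) →
  (b ≡ true → 1 ≤ occ (s ++ [ false ]) (p ++ s)) → ZeroFirst m ((p ++ s) ++ [ b ])
zeroFirst-∷ʳ m p s b ls zf s0 u lu u1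
  rewrite occ-∷ʳ u true p s b (trans lu (sym ls)) | occ-∷ʳ u false p s b (trans lu (sym ls))
  with 1≤+𝟙∧⁻ _ (u == s) (true ==b b) u1
... | inj₁ old          = ≤-trans (zf u lu old) (m≤m+n _ _)
... | inj₂ (u≡s , b≡1) =
  ≤-trans (subst (λ u′ → 1 ≤ occ (u′ ++ [ false ]) (p ++ s)) (sym (==⇒≡ u≡s)) (s0 (sym (==b⇒≡ b≡1))))
          (m≤m+n _ _)

appendRejected⇒occurs : ∀ m p s b → length s ≡ m → AtMostOnce (suc m) (p ++ s) →
  uniqueWindows (suc m) ((p ++ s) ++ [ b ]) ≡ false → 1 ≤ occ (s ++ [ b ]) (p ++ s)
appendRejected⇒occurs m p s b ls once rejected with occ (s ++ [ b ]) (p ++ s) in o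
... | suc _ = s≤s z≤n
... | zero
  with () ← trans (sym (atMostOnce⇒uniqueWindows m ((p ++ s) ++ [ b ]) (atMostOnce-∷ʳ m p s b ls once o)))
                  rejected

record Stuck (m : ℕ) (L : Bits) : Set where
  field
    prefix suffix : Bits
    split         : L ≡ prefix ++ suffix
    length-suffix : length suffix ≡ m
    occurs-0      : 1 ≤ occ (suffix ++ [ false ]) L
    occurs-1      : 1 ≤ occ (suffix ++ [ true ]) L

record GreedyOutcome (m f : ℕ) (x L : Bits) : Set where
  field
    unique    : AtMostOnce (suc m) L
    zeroFirst : ZeroFirst m L
    bounded   : length L ≤ length x + f
    finished  : length L ≡ length x + f ⊎ Stuck m L

greedyOutcome-∷ʳ : ∀ {m f x L} b → GreedyOutcome m f (x ++ [ b ]) L → GreedyOutcome m (suc f) x L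
greedyOutcome-∷ʳ {m} {f} {x} {L} b o = record
  { unique    = unique
  ; zeroFirst = zeroFirst
  ; bounded   = subst (length L ≤_) length-x+b+f bounded
  ; finished  = map₁ (λ e → trans e length-x+b+f) finished
  }
  where
  open GreedyOutcome o
  length-x+b+f : length (x ++ [ b ]) + f ≡ length x + suc f
  length-x+b+f = trans (cong (_+ f) (length-∷ʳ x b refl)) (sym (+-suc (length x) f))

greedy : ∀ m f x → m ≤ length x → AtMostOnce (suc m) x → ZeroFirst m x →
  GreedyOutcome m f x (dbLoop (suc m) f x)
greedy m zero x _ once zf = record
  { unique = once ; zeroFirst = zf ; bounded = m≤m+n _ 0 ; finished = inj₁ (sym (+-identityʳ _)) }
greedy m (suc f) x m≤ once zf with splitSuffix m x m≤
... | p , s , refl , ls with uniqueWindows (suc m) ((p ++ s) ++ [ false ]) in ok0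
... | true = greedyOutcome-∷ʳ false
      (greedy m f ((p ++ s) ++ [ false ]) (≤-trans m≤ (length-++-≤ˡ (p ++ s)))
              (uniqueWindows⇒atMostOnce m ((p ++ s) ++ [ false ]) ok0)
              (zeroFirst-∷ʳ m p s false ls zf (λ ())))
... | false with uniqueWindows (suc m) ((p ++ s) ++ [ true ]) in ok1
...   | true = greedyOutcome-∷ʳ true
        (greedy m f ((p ++ s) ++ [ true ]) (≤-trans m≤ (length-++-≤ˡ (p ++ s)))
                (uniqueWindows⇒atMostOnce m ((p ++ s) ++ [ true ]) ok1)
                (zeroFirst-∷ʳ m p s true ls zf (λ _ → appendRejected⇒occurs m p s false ls once ok0)))
...   | false = record
        { unique = once ; zeroFirst = zf ; bounded = m≤m+n _ _
        ; finished = inj₂ (record { prefix = p ; suffix = s ; split = refl ; length-suffix = ls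
                                  ; occurs-0 = appendRejected⇒occurs m p s false ls once ok0
                                  ; occurs-1 = appendRejected⇒occurs m p s true ls once ok1 }) }

dbLoop-extends : ∀ n f x → ∃ λ r → dbLoop n f x ≡ x ++ r
dbLoop-extends n zero x = [] , sym (++-identityʳ x)
dbLoop-extends n (suc f) x with uniqueWindows n (x ++ [ false ])
... | true  = let r , e = dbLoop-extends n f (x ++ [ false ]) in false ∷ r , trans e (++-assoc x [ false ] r)
... | false with uniqueWindows n (x ++ [ true ])
...   | true  = let r , e = dbLoop-extends n f (x ++ [ true ]) in true ∷ r , trans e (++-assoc x [ true ] r)
...   | false = [] , sym (++-identityʳ x)

countZeros : Bits → ℕ
countZeros []          = 0
countZeros (false ∷ x) = suc (countZeros x)
countZeros (true ∷ x)  = countZeros x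

countZeros-++ : ∀ a b → countZeros (a ++ b) ≡ countZeros a + countZeros b
countZeros-++ []          b = refl
countZeros-++ (false ∷ a) b = cong suc (countZeros-++ a b)
countZeros-++ (true ∷ a)  b = countZeros-++ a b

countZeros-ones : ∀ k → countZeros (ones k) ≡ 0
countZeros-ones zero    = refl
countZeros-ones (suc k) = countZeros-ones k

countZeros-zeros : ∀ k → countZeros (zeros k) ≡ k
countZeros-zeros zero    = refl
countZeros-zeros (suc k) = cong suc (countZeros-zeros k)

countZeros-infix : ∀ a v r → countZeros v ≤ countZeros (a ++ v ++ r)
countZeros-infix a v r rewrite countZeros-++ a (v ++ r) | countZeros-++ v r =
  ≤-trans (m≤m+n (countZeros v) (countZeros r)) (m≤n+m _ (countZeros a))

countZeros-absent : ∀ v z → countZeros z < countZeros v → occ v z ≡ 0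
countZeros-absent v z lt with occ v z in o
... | zero  = refl
... | suc _ with occ⇒infix v z (subst (1 ≤_) (sym o) (s≤s z≤n))
...   | a , r , refl = ⊥-elim (<⇒≱ lt (countZeros-infix a v r))

ones++zeros-unique : ∀ m k → k ≤ suc m → AtMostOnce (suc m) (ones m ++ zeros k)
ones++zeros-unique m zero _ v lv
  rewrite ++-identityʳ (ones m) | occ-short v (ones m) (subst₂ _<_ (sym (length-replicate m)) (sym lv) ≤-refl)
  = z≤n
ones++zeros-unique m (suc k) (s≤s k≤m) =
  subst (AtMostOnce (suc m)) (trans (cong (_++ [ false ]) (sym split)) (ones++zeros-∷ʳ m k))
    (atMostOnce-∷ʳ m (ones k) s false ls
      (subst (AtMostOnce (suc m)) split (ones++zeros-unique m k (m≤n⇒m≤1+n k≤m)))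
      (subst (λ y → occ (s ++ [ false ]) y ≡ 0) split
             (countZeros-absent (s ++ [ false ]) (ones m ++ zeros k) more0s)))
  where
  open ≡-Reasoning
  s = ones (m ∸ k) ++ zeros k
  split : ones m ++ zeros k ≡ ones k ++ s
  split = begin
    ones m ++ zeros k                   ≡⟨ cong (λ j → ones j ++ zeros k) (m+[n∸m]≡n k≤m) ⟨
    ones (k + (m ∸ k)) ++ zeros k       ≡⟨ cong (_++ zeros k) (replicate-+ k (m ∸ k) true) ⟩
    (ones k ++ ones (m ∸ k)) ++ zeros k ≡⟨ ++-assoc (ones k) (ones (m ∸ k)) (zeros k) ⟩
    ones k ++ s                         ∎
  ls : length s ≡ m
  ls = begin
    length (ones (m ∸ k) ++ zeros k)         ≡⟨ length-++ (ones (m ∸ k)) ⟩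
    length (ones (m ∸ k)) + length (zeros k) ≡⟨ cong₂ _+_ (length-replicate (m ∸ k)) (length-replicate k) ⟩
    m ∸ k + k                                ≡⟨ m∸n+n≡m k≤m ⟩
    m                                        ∎
  more0s : countZeros (ones m ++ zeros k) < countZeros (s ++ [ false ])
  more0s rewrite countZeros-++ s [ false ] | countZeros-++ (ones (m ∸ k)) (zeros k)
               | countZeros-++ (ones m) (zeros k) | countZeros-ones (m ∸ k) | countZeros-ones m
               | countZeros-zeros k = ≤-reflexive (+-comm 1 k)

dbLoop-leadingZeros : ∀ m j k f → j + k ≡ suc m →
  dbLoop (suc m) (j + f) (ones m ++ zeros k) ≡ dbLoop (suc m) f (ones m ++ zeros (suc m))
dbLoop-leadingZeros m zero    k f e rewrite e = refl
dbLoop-leadingZeros m (suc j) k f e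
  rewrite atMostOnce⇒uniqueWindows m ((ones m ++ zeros k) ++ [ false ])
            (subst (AtMostOnce (suc m)) (sym (ones++zeros-∷ʳ m k))
                   (ones++zeros-unique m (suc k) (subst (suc k ≤_) e (s≤s (m≤n+m k j)))))
        | ones++zeros-∷ʳ m k
  = dbLoop-leadingZeros m j (suc k) f (trans (+-suc j k) e)

-- Degrees in the greedy string

inDegree outDegree : Bits → Bits → ℕ
inDegree  u L = occ (false ∷ u) L + occ (true ∷ u) L
outDegree u L = occ (u ++ [ false ]) L + occ (u ++ [ true ]) L

occ-by-predecessor : ∀ u L → occ u L ≡ 𝟙 (isPrefix u L) + inDegree u L
occ-by-predecessor u [] = sym (+-identityʳ _)
occ-by-predecessor u (false ∷ L) rewrite occ-by-predecessor u L =
  cong (𝟙 (isPrefix u (false ∷ L)) +_) (sym (+-assoc (𝟙 (isPrefix u L)) _ _))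
occ-by-predecessor u (true ∷ L) rewrite occ-by-predecessor u L =
  cong (𝟙 (isPrefix u (true ∷ L)) +_)
       (x∙yz≈y∙xz (𝟙 (isPrefix u L)) (occ (false ∷ u) L) (occ (true ∷ u) L))

𝟙-isPrefix-by-successor : ∀ u z → length u < length z →
  𝟙 (isPrefix u z) ≡ 𝟙 (isPrefix (u ++ [ false ]) z) + 𝟙 (isPrefix (u ++ [ true ]) z)
𝟙-isPrefix-by-successor []          (false ∷ z) _       = refl
𝟙-isPrefix-by-successor []          (true ∷ z)  _       = refl
𝟙-isPrefix-by-successor (false ∷ u) (false ∷ z) (s≤s l) = 𝟙-isPrefix-by-successor u z l
𝟙-isPrefix-by-successor (false ∷ u) (true ∷ z)  _       = refl
𝟙-isPrefix-by-successor (true ∷ u)  (false ∷ z) _       = refl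
𝟙-isPrefix-by-successor (true ∷ u)  (true ∷ z)  (s≤s l) = 𝟙-isPrefix-by-successor u z l

occ-by-successor : ∀ u p s → length u ≡ length s → occ u (p ++ s) ≡ 𝟙 (u == s) + outDegree u (p ++ s)
occ-by-successor u [] s e
  rewrite occ-sameLength u s (sym e)
        | occ-∷ʳ-short u false s e | occ-∷ʳ-short u true s e
        | sym (isPrefix-sameLength u s [] e) | ++-identityʳ s = sym (+-identityʳ _)
occ-by-successor u (a ∷ p) s e
  rewrite occ-by-successor u p s e
        | 𝟙-isPrefix-by-successor u (a ∷ p ++ s)
            (s≤s (subst₂ _≤_ (sym e) (sym (length-++ p)) (m≤n+m (length s) (length p))))
  = trans (x∙yz≈y∙xz (A + B) (𝟙 (u == s)) _) (cong (𝟙 (u == s) +_) (interchange A B _ _))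
  where
  A = 𝟙 (isPrefix (u ++ [ false ]) (a ∷ p ++ s))
  B = 𝟙 (isPrefix (u ++ [ true ]) (a ∷ p ++ s))

record GreedyString (m : ℕ) (L : Bits) : Set where
  field
    unique         : AtMostOnce (suc m) L
    zeroFirst      : ZeroFirst m L
    rest           : Bits
    startsWithOnes : L ≡ ones m ++ rest

module _ {m L} (G : GreedyString m L) where
  open GreedyString G

  isPrefix-greedy : ∀ u → length u ≡ m → isPrefix u L ≡ (u == ones m)
  isPrefix-greedy u lu rewrite startsWithOnes =
    isPrefix-sameLength u (ones m) rest (trans lu (sym (length-replicate m)))

  inDegree≤2 : ∀ u → length u ≡ m → inDegree u L ≤ 2
  inDegree≤2 u lu = +-mono-≤ (unique (false ∷ u) (cong suc lu)) (unique (true ∷ u) (cong suc lu))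

  stuckSuffix≡ones : ∀ p s → L ≡ p ++ s → length s ≡ m →
    1 ≤ occ (s ++ [ false ]) L → 1 ≤ occ (s ++ [ true ]) L → s ≡ ones m
  stuckSuffix≡ones p s L≡ ls s0 s1 = ==⇒≡ (trans (sym (isPrefix-greedy s ls)) (𝟙-pos prefix))
    where
    occ-s : 𝟙 (isPrefix s L) + inDegree s L ≡ suc (outDegree s L)
    occ-s = begin
      𝟙 (isPrefix s L) + inDegree s L   ≡⟨ occ-by-predecessor s L ⟨
      occ s L                           ≡⟨ cong (occ s) L≡ ⟩
      occ s (p ++ s)                    ≡⟨ occ-by-successor s p s refl ⟩
      𝟙 (s == s) + outDegree s (p ++ s) ≡⟨ cong₂ (λ q y → 𝟙 q + outDegree s y) (==-refl s) (sym L≡) ⟩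
      suc (outDegree s L)               ∎
      where open ≡-Reasoning
    prefix : 1 ≤ 𝟙 (isPrefix s L)
    prefix = +-cancelʳ-≤ 2 1 (𝟙 (isPrefix s L)) (begin
      1 + 2                              ≤⟨ s≤s (+-mono-≤ s0 s1) ⟩
      suc (outDegree s L)                ≡⟨ occ-s ⟨
      𝟙 (isPrefix s L) + inDegree s L    ≤⟨ +-monoʳ-≤ (𝟙 (isPrefix s L)) (inDegree≤2 s ls) ⟩
      𝟙 (isPrefix s L) + 2               ∎)
      where open ≤-Reasoning

  Balanced : Set
  Balanced = ∀ u → length u ≡ m → inDegree u L ≡ outDegree u L

  endsWithOnes⇒balanced : ∀ p → L ≡ p ++ ones m → Balanced
  endsWithOnes⇒balanced p L≡ u lu = +-cancelˡ-≡ (𝟙 (u == ones m)) _ _ (begin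
    𝟙 (u == ones m) + inDegree u L              ≡⟨ cong (λ q → 𝟙 q + inDegree u L) (isPrefix-greedy u lu) ⟨
    𝟙 (isPrefix u L) + inDegree u L             ≡⟨ occ-by-predecessor u L ⟨
    occ u L                                     ≡⟨ cong (occ u) L≡ ⟩
    occ u (p ++ ones m)                         ≡⟨ occ-by-successor u p (ones m) (trans lu (sym (length-replicate m))) ⟩
    𝟙 (u == ones m) + outDegree u (p ++ ones m) ≡⟨ cong (λ y → 𝟙 (u == ones m) + outDegree u y) L≡ ⟨
    𝟙 (u == ones m) + outDegree u L             ∎)
    where open ≡-Reasoning

  balanced⇒predecessors : Balanced → ∀ u → length u ≡ m →
    2 ≤ outDegree u L → ∀ b → 1 ≤ occ (b ∷ u) L
  balanced⇒predecessors bal u lu out b = bit b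
    where
    in≥2 : 2 ≤ inDegree u L
    in≥2 = subst (2 ≤_) (sym (bal u lu)) out
    bit : ∀ b → 1 ≤ occ (b ∷ u) L
    bit false = +-cancelʳ-≤ 1 1 _ (≤-trans in≥2 (+-monoʳ-≤ _ (unique (true ∷ u) (cong suc lu))))
    bit true  = +-cancelˡ-≤ 1 1 _ (≤-trans in≥2 (+-monoˡ-≤ _ (unique (false ∷ u) (cong suc lu))))

  balanced⇒covers : Balanced → 1 ≤ occ (ones (suc m)) L → Covers (suc m) L
  balanced⇒covers bal ones-occurs v lv =
    subst (λ z → 1 ≤ occ z L) (++-identityʳ v) (endingInOnes v 0 (trans (+-identityʳ _) lv))
    where
    endingInOnes : ∀ r j → length r + j ≡ suc m → 1 ≤ occ (r ++ ones j) L
    endingInOnes []      j e rewrite e = ones-occurs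
    endingInOnes (b ∷ r) j e = balanced⇒predecessors bal u lu (+-mono-≤ (zeroFirst u lu u1) u1) b
      where
      u = r ++ ones j
      lu : length u ≡ m
      lu = suc-injective (trans (cong suc (trans (length-++ r) (cong (length r +_) (length-replicate j)))) e)
      u1 : 1 ≤ occ (u ++ [ true ]) L
      u1 = subst (λ z → 1 ≤ occ z L)
                 (sym (trans (++-assoc r (ones j) [ true ]) (cong (r ++_) (replicate-∷ʳ j true))))
                 (endingInOnes r (suc j) (trans (+-suc (length r) j) e))

-- Counting windows

words : ℕ → List Bits
words zero    = [ [] ]
words (suc n) = map (false ∷_) (words n) ++ map (true ∷_) (words n)

sumWords : ℕ → (Bits → ℕ) → ℕ
sumWords n f = sum (map f (words n))

sumWords-suc : ∀ n f →
  sumWords (suc n) f ≡ sumWords n (λ v → f (false ∷ v)) + sumWords n (λ v → f (true ∷ v))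
sumWords-suc n f = begin
  sum (map f (map (false ∷_) (words n) ++ map (true ∷_) (words n)))
    ≡⟨ cong sum (map-++ f (map (false ∷_) (words n)) _) ⟩
  sum (map f (map (false ∷_) (words n)) ++ map f (map (true ∷_) (words n)))
    ≡⟨ sum-++ (map f (map (false ∷_) (words n))) _ ⟩
  sum (map f (map (false ∷_) (words n))) + sum (map f (map (true ∷_) (words n)))
    ≡⟨ cong₂ _+_ (cong sum (map-∘ (words n))) (cong sum (map-∘ (words n))) ⟨
  sumWords n (λ v → f (false ∷ v)) + sumWords n (λ v → f (true ∷ v)) ∎
  where open ≡-Reasoning

sum-map-+ : ∀ (f g : Bits → ℕ) xs → sum (map (λ v → f v + g v) xs) ≡ sum (map f xs) + sum (map g xs)
sum-map-+ f g []       = refl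
sum-map-+ f g (x ∷ xs) = trans (cong (f x + g x +_) (sum-map-+ f g xs)) (interchange (f x) (g x) _ _)

sumWords-mono : ∀ n {f g} → (∀ v → length v ≡ n → f v ≤ g v) → sumWords n f ≤ sumWords n g
sumWords-mono zero    f≤g = +-monoˡ-≤ 0 (f≤g [] refl)
sumWords-mono (suc n) {f} {g} f≤g rewrite sumWords-suc n f | sumWords-suc n g =
  +-mono-≤ (sumWords-mono n (λ v lv → f≤g (false ∷ v) (cong suc lv)))
           (sumWords-mono n (λ v lv → f≤g (true ∷ v) (cong suc lv)))

sumWords-const1 : ∀ n → sumWords n (λ _ → 1) ≡ 2 ^ n
sumWords-const1 zero    = refl
sumWords-const1 (suc n) rewrite sumWords-suc n (λ _ → 1) | sumWords-const1 n =
  cong (2 ^ n +_) (sym (+-identityʳ (2 ^ n)))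

sumWords-const0 : ∀ n → sumWords n (λ _ → 0) ≡ 0
sumWords-const0 zero    = refl
sumWords-const0 (suc n) rewrite sumWords-suc n (λ _ → 0) | sumWords-const0 n = refl

sumWords-isPrefix : ∀ n z → n ≤ length z → sumWords n (λ v → 𝟙 (isPrefix v z)) ≡ 1
sumWords-isPrefix zero    z           _       = refl
sumWords-isPrefix (suc n) (false ∷ z) (s≤s l)
  rewrite sumWords-suc n (λ v → 𝟙 (isPrefix v (false ∷ z))) | sumWords-isPrefix n z l | sumWords-const0 n
  = refl
sumWords-isPrefix (suc n) (true ∷ z)  (s≤s l)
  rewrite sumWords-suc n (λ v → 𝟙 (isPrefix v (true ∷ z))) | sumWords-isPrefix n z l | sumWords-const0 n
  = refl

sumWords-occ : ∀ n L → suc (length L) ∸ n ≤ sumWords n (λ v → occ v L)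
sumWords-occ zero    []      = ≤-refl
sumWords-occ (suc n) []      rewrite 0∸n≡0 n = z≤n
sumWords-occ n       (c ∷ L) with n ≤? length (c ∷ L)
... | no  n≰ rewrite m≤n⇒m∸n≡0 (≰⇒> n≰) = z≤n
... | yes n≤ = begin
  suc (suc (length L)) ∸ n                     ≡⟨ +-∸-assoc 1 n≤ ⟩
  suc (suc (length L) ∸ n)                     ≤⟨ s≤s (sumWords-occ n L) ⟩
  1 + sumWords n (λ v → occ v L)               ≡⟨ cong (_+ _) (sumWords-isPrefix n (c ∷ L) n≤) ⟨
  sumWords n (λ v → 𝟙 (isPrefix v (c ∷ L))) + sumWords n (λ v → occ v L)
                                               ≡⟨ sum-map-+ (λ v → 𝟙 (isPrefix v (c ∷ L))) (λ v → occ v L) (words n) ⟨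
  sumWords n (λ v → occ v (c ∷ L))             ∎
  where open ≤-Reasoning

atMostOnce∧long⇒covers : ∀ m L → AtMostOnce (suc m) L → length L ≡ m + 2 ^ suc m → Covers (suc m) L
atMostOnce∧long⇒covers m L once lL w lw with occ w L in missing
... | suc _ = s≤s z≤n
... | zero  = ⊥-elim (<-irrefl refl (begin-strict
  2 ^ N                                                     ≡⟨ length-windows ⟨
  suc (length L) ∸ N                                        ≤⟨ sumWords-occ N L ⟩
  sumWords N (λ v → occ v L)                                <⟨ m<m+n _ (s≤s z≤n) ⟩
  sumWords N (λ v → occ v L) + 1                            ≡⟨ cong (_ +_) (sumWords-isPrefix N w (≤-reflexive (sym lw))) ⟨
  sumWords N (λ v → occ v L) + sumWords N (λ v → 𝟙 (isPrefix v w))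
                                                            ≡⟨ sum-map-+ (λ v → occ v L) (λ v → 𝟙 (isPrefix v w)) (words N) ⟨
  sumWords N (λ v → occ v L + 𝟙 (isPrefix v w))             ≤⟨ sumWords-mono N bound ⟩
  sumWords N (λ _ → 1)                                      ≡⟨ sumWords-const1 N ⟩
  2 ^ N                                                     ∎))
  where
  open ≤-Reasoning
  N = suc m
  length-windows : suc (length L) ∸ N ≡ 2 ^ N
  length-windows rewrite lL = m+n∸m≡n m (2 ^ N)
  bound : ∀ v → length v ≡ N → occ v L + 𝟙 (isPrefix v w) ≤ 1
  bound v lv with isPrefix v w in v≤w
  ... | false = subst (_≤ 1) (sym (+-identityʳ _)) (once v lv)
  ... | true  = subst (λ u → occ u L + 1 ≤ 1) (sym v≡w) (subst (λ k → k + 1 ≤ 1) (sym missing) ≤-refl)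
    where
    v≡w : v ≡ w
    v≡w = trans (isPrefix⇒≡take v w v≤w)
                (trans (cong (λ k → take k w) (trans lv (sym lw))) (take-all (length w) w ≤-refl))

-- The de Bruijn string

n≤2^n : ∀ n → n ≤ 2 ^ n
n≤2^n zero    = z≤n
n≤2^n (suc n) = +-mono-≤ (m^n>0 2 n) (≤-trans (n≤2^n n) (m≤m+n _ 0))

module _ (m : ℕ) where
  private
    N = suc m
    L = dbLoop N (2 ^ N) (ones m)

  dbLoop-leading : ∃ λ r → L ≡ ones m ++ zeros N ++ r
  dbLoop-leading = r , (begin
    L                                            ≡⟨ cong₂ (dbLoop N) (m+[n∸m]≡n (n≤2^n N)) (++-identityʳ (ones m)) ⟨
    dbLoop N (N + (2 ^ N ∸ N)) (ones m ++ zeros 0) ≡⟨ dbLoop-leadingZeros m N 0 (2 ^ N ∸ N) (+-identityʳ N) ⟩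
    dbLoop N (2 ^ N ∸ N) (ones m ++ zeros N)     ≡⟨ proj₂ extension ⟩
    (ones m ++ zeros N) ++ r                     ≡⟨ ++-assoc (ones m) (zeros N) r ⟩
    ones m ++ zeros N ++ r                       ∎)
    where
    open ≡-Reasoning
    extension = dbLoop-extends N (2 ^ N ∸ N) (ones m ++ zeros N)
    r = proj₁ extension

  db-leadingZeros : ∃ λ r → db N ≡ zeros N ++ r
  db-leadingZeros = let r , L≡ = dbLoop-leading in r , trans (cong (drop m) L≡) (drop-ones m (zeros N ++ r))

  dbLoop≡ones++db : L ≡ ones m ++ db N
  dbLoop≡ones++db = trans (proj₂ dbLoop-leading) (cong (ones m ++_) (sym (proj₂ db-leadingZeros)))

  private
    run : GreedyOutcome m (2 ^ N) (ones m) L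
    run = greedy m (2 ^ N) (ones m) (≤-reflexive (sym (length-replicate m)))
                 (subst (AtMostOnce N) (++-identityʳ (ones m)) (ones++zeros-unique m 0 z≤n))
                 (short⇒zeroFirst m (ones m) (≤-reflexive (length-replicate m)))

    greedyString : GreedyString m L
    greedyString = record
      { unique = GreedyOutcome.unique run ; zeroFirst = GreedyOutcome.zeroFirst run
      ; rest = db N ; startsWithOnes = dbLoop≡ones++db }

    length-L : length L ≡ m + length (db N)
    length-L = trans (cong length dbLoop≡ones++db)
                     (trans (length-++ (ones m)) (cong (_+ length (db N)) (length-replicate m)))

    finalSuffix : ∃₂ λ p s → L ≡ p ++ s × length s ≡ m
    finalSuffix = splitSuffix m L (subst (m ≤_) (sym length-L) (m≤m+n m _))

  dbLoop-covers×endsWithOnes : Covers N L × ∃ λ p → L ≡ p ++ ones m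
  dbLoop-covers×endsWithOnes with GreedyOutcome.finished run
  ... | inj₂ stuck = covers , prefix , L≡
    where
    open Stuck stuck
    suffix≡ones = stuckSuffix≡ones greedyString prefix suffix split length-suffix occurs-0 occurs-1
    L≡ = trans split (cong (prefix ++_) suffix≡ones)
    covers = balanced⇒covers greedyString (endsWithOnes⇒balanced greedyString prefix L≡)
               (subst (λ z → 1 ≤ occ z L)
                      (trans (cong (_++ [ true ]) suffix≡ones) (replicate-∷ʳ m true)) occurs-1)
  ... | inj₁ full = covers , p , trans L≡ (cong (p ++_) s≡ones)
    where
    covers = atMostOnce∧long⇒covers m L (GreedyOutcome.unique run)
                                    (trans full (cong (_+ 2 ^ N) (length-replicate m)))
    p = proj₁ finalSuffix
    s = proj₁ (proj₂ finalSuffix)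
    L≡ = proj₁ (proj₂ (proj₂ finalSuffix))
    ls = proj₂ (proj₂ (proj₂ finalSuffix))
    s≡ones = stuckSuffix≡ones greedyString p s L≡ ls
               (covers (s ++ [ false ]) (length-∷ʳ s false ls))
               (covers (s ++ [ true ]) (length-∷ʳ s true ls))

  db-length : length (db N) ≤ 2 ^ N
  db-length = +-cancelˡ-≤ m _ _ (subst (_≤ m + 2 ^ N) length-L
    (subst (λ k → length L ≤ k + 2 ^ N) (length-replicate m) (GreedyOutcome.bounded run)))

  db-endsWithOnes : ∃ λ C → db N ≡ C ++ ones m
  db-endsWithOnes = ++-suffix (ones m) (db N) (proj₁ (proj₂ dbLoop-covers×endsWithOnes)) (ones m)
                      (trans (sym dbLoop≡ones++db) (proj₂ (proj₂ dbLoop-covers×endsWithOnes)))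
                      (≤-trans (≤-reflexive (length-replicate m)) m≤length-db)
    where
    m≤length-db : m ≤ length (db N)
    m≤length-db = begin
      m                                         ≤⟨ n≤1+n m ⟩
      N                                         ≡⟨ length-replicate N ⟨
      length (zeros N)                          ≤⟨ length-++-≤ˡ (zeros N) ⟩
      length (zeros N ++ proj₁ db-leadingZeros) ≡⟨ cong length (proj₂ db-leadingZeros) ⟨
      length (db N)                             ∎
      where open ≤-Reasoning

  db-covers : Covers N (db N ++ zeros m)
  db-covers v lv
    with occ-++-split v (ones m) (db N)
           (subst (λ z → 1 ≤ occ v z) dbLoop≡ones++db (proj₁ dbLoop-covers×endsWithOnes v lv))
  ... | inj₂ inDb       = ≤-trans inDb (occ-++ʳ-mono v (db N) (zeros m))
  ... | inj₁ acrossJoin = begin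
    -- the occurrence lies in 1^m 0^m, which also straddles the end of db N = C 1^m
    1                                ≤⟨ subst (λ q → 1 ≤ occ v (ones m ++ q)) joinZeros acrossJoin ⟩
    occ v (ones m ++ zeros m)        ≤⟨ occ-++ˡ-mono v C (ones m ++ zeros m) ⟩
    occ v (C ++ ones m ++ zeros m)   ≡⟨ cong (occ v) (++-assoc C (ones m) (zeros m)) ⟨
    occ v ((C ++ ones m) ++ zeros m) ≡⟨ cong (λ y → occ v (y ++ zeros m)) (proj₂ db-endsWithOnes) ⟨
    occ v (db N ++ zeros m)          ∎
    where
    open ≤-Reasoning
    C = proj₁ db-endsWithOnes
    joinZeros : take (length v ∸ 1) (db N) ≡ zeros m
    joinZeros = trans (cong (λ j → take (j ∸ 1) (db N)) lv)
                      (trans (cong (take m) (proj₂ db-leadingZeros)) (take-zeros m (proj₁ db-leadingZeros)))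

-- The block S_n

half-≤ : ∀ m → half m ≤ m
half-≤ zero          = z≤n
half-≤ (suc zero)    = z≤n
half-≤ (suc (suc m)) = s≤s (m≤n⇒m≤1+n (half-≤ m))

half+half : ∀ m → isEven m ≡ true → half m + half m ≡ m
half+half zero          _ = refl
half+half (suc (suc m)) e rewrite +-suc (half m) (half m) = cong (λ k → suc (suc k)) (half+half m e)

Factorises : ℕ → ℕ × ℕ → Set
Factorises n (s , t) = 2 ^ s * t ≡ n

twoAdicGo-factorises : ∀ f m → suc m ≤ f → Factorises (suc m) (twoAdicGo f (suc m))
twoAdicGo-factorises (suc f) zero    _       = refl
twoAdicGo-factorises (suc f) (suc m) (s≤s l) with isEven m in even
... | false = +-identityʳ _
... | true with twoAdicGo f (suc (half m)) | twoAdicGo-factorises f (half m) (≤-trans (s≤s (half-≤ m)) l)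
...   | (s , t) | ih rewrite *-assoc 2 (2 ^ s) t | ih | +-identityʳ (suc (half m))
                           | +-suc (half m) (half m) | half+half m even = refl

twoAdic-factorises : ∀ n → Factorises n (twoAdic n)
twoAdic-factorises zero    = refl
twoAdic-factorises (suc m) = twoAdicGo-factorises (suc m) m ≤-refl

blocks : (ℕ → Bits) → ℕ → ℕ → Bits
blocks D s t = concat (map (λ i → pow (D i) t) (upTo (2 ^ s)))

blocks-twoLeading : ∀ D s t → 2 ≤ 2 ^ s * t →
  ∃ λ i → i ≤ 1 × ∃ λ R → blocks D s t ≡ D 0 ++ D i ++ R
blocks-twoLeading D s zero h rewrite *-zeroʳ (2 ^ s) with h
... | ()
blocks-twoLeading D s (suc zero) h with 2 ^ s | subst (2 ≤_) (*-identityʳ (2 ^ s)) h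
... | suc zero    | s≤s ()
... | suc (suc z) | _ = 1 , ≤-refl , R , cong₂ _++_ (++-identityʳ (D 0)) (cong (_++ R) (++-identityʳ (D 1)))
  where R = concat (map (λ i → pow (D i) 1) (applyUpTo (λ i → suc (suc i)) z))
blocks-twoLeading D s (suc (suc t)) h with 2 ^ s | m^n>0 2 s
... | suc z | _ = 0 , z≤n , _ , trans (++-assoc (D 0) _ _) (cong (D 0 ++_) (++-assoc (D 0) _ _))

dbRot-leadingZeros : ∀ m i → i ≤ 1 → ∃₂ λ b R → dbRot (suc m) i ≡ zeros m ++ b ∷ R
dbRot-leadingZeros m zero _ with db (suc m) | db-leadingZeros m
... | _ | r , refl = false , r ++ [] , trans (++-assoc (zeros (suc m)) r []) (zeros-suc-++ m (r ++ []))
dbRot-leadingZeros m (suc zero) _ with db (suc m) | db-leadingZeros m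
... | _ | r , refl =
  let b , R , r0 = ++-∷-nonEmpty r false []
  in  b , R , trans (++-assoc (zeros m) r [ false ]) (cong (zeros m ++_) r0)
dbRot-leadingZeros m (suc (suc i)) (s≤s ())

Sblock-leading : ∀ m → 1 ≤ m → ∃₂ λ b R → Sblock (suc m) ≡ db (suc m) ++ zeros m ++ b ∷ R
Sblock-leading m 1≤m with twoAdic (suc m) | twoAdic-factorises (suc m)
... | s , t | factors with blocks-twoLeading (dbRot (suc m)) s t (subst (2 ≤_) (sym factors) (s≤s 1≤m))
...   | i , i≤1 , R , start with dbRot-leadingZeros m i i≤1
...     | b , R′ , rot = b , R′ ++ R , (begin
  blocks (dbRot (suc m)) s t                 ≡⟨ start ⟩
  dbRot (suc m) 0 ++ dbRot (suc m) i ++ R    ≡⟨ cong₂ (λ x y → x ++ y ++ R) (++-identityʳ (db (suc m))) rot ⟩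
  db (suc m) ++ (zeros m ++ b ∷ R′) ++ R     ≡⟨ cong (db (suc m) ++_) (++-assoc (zeros m) (b ∷ R′) R) ⟩
  db (suc m) ++ zeros m ++ b ∷ R′ ++ R       ∎)
  where open ≡-Reasoning

db++zeros-fits : ∀ m b → length ((db (suc m) ++ zeros m) ++ [ b ]) ≤ 2 ^ suc m + suc m
db++zeros-fits m b = begin
  length ((db (suc m) ++ zeros m) ++ [ b ])    ≡⟨ length-∷ʳ (db (suc m) ++ zeros m) b refl ⟩
  suc (length (db (suc m) ++ zeros m))         ≡⟨ cong suc (length-++ (db (suc m))) ⟩
  suc (length (db (suc m)) + length (zeros m)) ≡⟨ cong (λ k → suc (length (db (suc m)) + k)) (length-replicate m) ⟩
  suc (length (db (suc m)) + m)                ≡⟨ +-suc (length (db (suc m))) m ⟨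
  length (db (suc m)) + suc m                  ≤⟨ +-monoˡ-≤ (suc m) (db-length m) ⟩
  2 ^ suc m + suc m                            ∎
  where open ≤-Reasoning

covers⇒isContext : ∀ m Y → Covers (suc m) Y →
  ∀ P b R w → length w ≡ suc m → IsContext (P ++ Y ++ b ∷ R) w
covers⇒isContext m Y covers P b R w lw with initLast w | lw
... | u ∷ʳ′ c | _ =
  ∷ʳ≢[] u c ,
  (proj₁ extension , ≤-trans (proj₂ extension) (occ-++ˡ-mono _ P (Y ++ b ∷ R))) ,
  subst (λ v → 2 ≤ occ v (P ++ Y ++ b ∷ R)) (sym (dropLast-∷ʳ u c))
    (≤-trans (occ-bothExtensions u Y (covers (u ++ [ false ]) lu0) (covers (u ++ [ true ]) lu1))
             (≤-trans (occ-++ʳ-mono u Y (b ∷ R)) (occ-++ˡ-mono u P (Y ++ b ∷ R))))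
  where
  extension = occ-extend (u ++ [ c ]) Y b R (covers (u ++ [ c ]) lw)
  lu0 = length-∷ʳ u false (length-∷ʳ⁻ u c lw)
  lu1 = length-∷ʳ u true (length-∷ʳ⁻ u c lw)

lemma2 : (n : ℕ) → 2 ≤ n → (w : Vec Bool n) →
    IsContext (Sprefix (n ∸ 1) ++ take (2 ^ n + n) (Sblock n)) (toList w)
lemma2 (suc m) (s≤s 1≤m) w =
  subst (λ z → IsContext (Sprefix m ++ z) (toList w)) (sym observed)
    (covers⇒isContext m Y (db-covers m) (Sprefix m) b R′ (toList w) (length-toList w))
  where
  open ≡-Reasoning
  K = 2 ^ suc m + suc m
  Y = db (suc m) ++ zeros m
  leading = Sblock-leading m 1≤m
  b = proj₁ leading
  R = proj₁ (proj₂ leading)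
  taken = take-++-prefix (Y ++ [ b ]) R K (db++zeros-fits m b)
  R′ = proj₁ taken
  observed : take K (Sblock (suc m)) ≡ Y ++ b ∷ R′
  observed = begin
    take K (Sblock (suc m))                    ≡⟨ cong (take K) (proj₂ (proj₂ leading)) ⟩
    take K (db (suc m) ++ zeros m ++ b ∷ R)    ≡⟨ cong (take K) (sym (++-assoc (db (suc m)) (zeros m) (b ∷ R))) ⟩
    take K (Y ++ b ∷ R)                        ≡⟨ cong (take K) (sym (++-assoc Y [ b ] R)) ⟩
    take K ((Y ++ [ b ]) ++ R)                 ≡⟨ proj₂ taken ⟩
    (Y ++ [ b ]) ++ R′                         ≡⟨ ++-assoc Y [ b ] R′ ⟩
    Y ++ b ∷ R′                                ∎
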